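{- Let $\beta$ be a Boolean combination of $x$-separated atomic formulas, let $ax<t$ or $t<ax$ be an atomic formula occurring in $\beta$ with $a>0$ (and $t$ an $x$-free term), let $p\ge1$ be an integer, and let $c\in\mathbb{Z}$ with $|c|\le a\cdot p\cdot\mathrm{lcm}\,\textsc{Mod}(\beta)$. Then there exists a Boolean combination $\beta_{a,t+c}$ of $x$-free atomic formulas such that the triple $(\beta,\beta_{a,t+c},p)$ satisfies Condition $(\ast)$ and, for every assignment $f$, $f(ax)=f(t+c)$ implies that $\beta$ and $\beta_{a,t+c}$ have the same truth value under $f$.
   Context: Integers with $+$, $<$, and $\equiv_k$ ($m\equiv_k n$ iff $k\mid m-n$). Terms are built from variables and integer constants by addition and multiplication by integers; each has a unique normal form $a_1x_{i_1}+\dots+a_nx_{i_n}+c$ with $i_1<\dots<i_n$, $a_j\neq0$ (coefficients $a_j$, constant $c$). An assignment maps variables to integers. A term is $x$-free if its normal form does not contain $x$; an atomic formula ($s<t$ or $s\equiv_k t$, $k\ge1$) is $x$-free if its terms are $x$-free. An atomic formula is $x$-separated if it has the form $ax<t$, $t<ax$ or $ax\equiv_k t$ with $a\in\mathbb{N}$ and $t$ an $x$-free term. A Boolean combination uses only $\neg,\land,\lor,\to,\leftrightarrow$. $\textsc{Coeff}(\varphi)$: $0,\pm1,\pm2$ and $\pm a$ for $a$ a coefficient of the normal form of $s_1-s_2$ for an atomic subformula $s_1<s_2$ of $\varphi$; $\textsc{Const}(\varphi)$: $0,\pm1,\pm2$ and $\pm c$ for $c$ the constant of such $s_1-s_2$;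 $\textsc{Mod}(\varphi)$: $1$ and all $k$ such that an atomic subformula $s_1\equiv_k s_2$ occurs in $\varphi$. For $p\ge1$: $\textsc{Coeff}_p(\beta)=\{a_1a_2-a_3a_4 : a_i\in\textsc{Coeff}(\beta)\}$; $\textsc{Const}_p(\beta)=\{a_1c_1-a_2(c_2+c): a_1,a_2\in\textsc{Coeff}(\beta),\ c_1,c_2\in\textsc{Const}(\beta),\ c\in\mathbb{Z},\ |c|\le\max\textsc{Coeff}(\beta)\cdot p\cdot\mathrm{lcm}\,\textsc{Mod}(\beta)\}$; $\textsc{Mod}_p(\beta)=\{a_1a_2k_1k_2: a_1,a_2\in\textsc{Coeff}(\beta),\ k_1,k_2\in\textsc{Mod}(\beta)\cup\{p\}\}$. A triple $(\beta,\gamma,p)$ satisfies Condition $(\ast)$ if $\textsc{Coeff}(\gamma)\subseteq\textsc{Coeff}_p(\beta)$, $\textsc{Const}(\gamma)\subseteq\textsc{Const}_p(\beta)$ and $\textsc{Mod}(\gamma)\subseteq\textsc{Mod}_p(\beta)$. -}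

module Defs where

open import Data.Nat as ℕ using (ℕ; zero; suc)
open import Data.Nat.LCM using (lcm)
import Data.Nat.Divisibility as ℕD
open import Data.Integer as ℤ using (ℤ; +_; -_; _-_; _*_; ∣_∣)
import Data.Integer.Properties as ℤP
open import Data.Bool using (Bool; true; false; not; _∧_; _∨_; if_then_else_)
open import Data.List using (List; []; _∷_; _++_; foldr)
open import Data.Product using (Σ; ∃; _×_; _,_)
open import Data.Sum using (_⊎_)
open import Relation.Binary.PropositionalEquality using (_≡_; _≢_)
open import Relation.Nullary.Decidable using (⌊_⌋)

infixl 6 _⊕_

data Term : Set where
  var   : ℕ → Term
  const : ℤ → Term
  _⊕_   : Term → Term → Term
  scale : ℤ → Term → Term

-- The normal form a_1 x_{i_1} + ... + a_n x_{i_n} + c of a term, given as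
-- the (finitely supported) coefficient function i ↦ coefficient of x_i
-- (0 if x_i does not occur) together with the constant c.
coeffNF : Term → ℕ → ℤ
coeffNF (var j)     i = if ⌊ j ℕ.≟ i ⌋ then + 1 else + 0
coeffNF (const c)   i = + 0
coeffNF (s ⊕ t)     i = coeffNF s i ℤ.+ coeffNF t i
coeffNF (scale a s) i = a * coeffNF s i

constNF : Term → ℤ
constNF (var j)     = + 0
constNF (const c)   = c
constNF (s ⊕ t)     = constNF s ℤ.+ constNF t
constNF (scale a s) = a * constNF s

_⊖_ : Term → Term → Term
s ⊖ t = s ⊕ scale (- + 1) t

_·v_ : ℕ → ℕ → Term
a ·v x = scale (+ a) (var x)

Assignment : Set
Assignment = ℕ → ℤ

eval : Assignment → Term → ℤ
eval f (var i)     = f i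
eval f (const c)   = c
eval f (s ⊕ t)     = eval f s ℤ.+ eval f t
eval f (scale a s) = a * eval f s

XFreeTerm : ℕ → Term → Set
XFreeTerm x t = coeffNF t x ≡ + 0

data Formula : Set where
  _<'_   : Term → Term → Formula
  congr  : (k : ℕ) → 1 ℕ.≤ k → Term → Term → Formula
  ¬'_    : Formula → Formula
  _∧'_   : Formula → Formula → Formula
  _∨'_   : Formula → Formula → Formula
  _⇒'_   : Formula → Formula → Formula
  _⇔'_   : Formula → Formula → Formula

data IsAtomic : Formula → Set where
  lt-atomic  : ∀ s t → IsAtomic (s <' t)
  mod-atomic : ∀ k k≥1 s t → IsAtomic (congr k k≥1 s t)

data _∈At_ : Formula → Formula → Set where
  here-lt  : ∀ {s t} → (s <' t) ∈At (s <' t)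
  here-mod : ∀ {k k≥1 s t} → congr k k≥1 s t ∈At congr k k≥1 s t
  in-¬     : ∀ {φ ψ} → φ ∈At ψ → φ ∈At (¬' ψ)
  in-∧ˡ    : ∀ {φ ψ χ} → φ ∈At ψ → φ ∈At (ψ ∧' χ)
  in-∧ʳ    : ∀ {φ ψ χ} → φ ∈At χ → φ ∈At (ψ ∧' χ)
  in-∨ˡ    : ∀ {φ ψ χ} → φ ∈At ψ → φ ∈At (ψ ∨' χ)
  in-∨ʳ    : ∀ {φ ψ χ} → φ ∈At χ → φ ∈At (ψ ∨' χ)
  in-⇒ˡ    : ∀ {φ ψ χ} → φ ∈At ψ → φ ∈At (ψ ⇒' χ)
  in-⇒ʳ    : ∀ {φ ψ χ} → φ ∈At χ → φ ∈At (ψ ⇒' χ)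
  in-⇔ˡ    : ∀ {φ ψ χ} → φ ∈At ψ → φ ∈At (ψ ⇔' χ)
  in-⇔ʳ    : ∀ {φ ψ χ} → φ ∈At χ → φ ∈At (ψ ⇔' χ)

⟦_⟧ : Formula → Assignment → Bool
⟦ s <' t ⟧         f = ⌊ eval f s ℤP.<? eval f t ⌋
⟦ congr k _ s t ⟧  f = ⌊ k ℕD.∣? ∣ eval f s - eval f t ∣ ⌋
⟦ ¬' φ ⟧           f = not (⟦ φ ⟧ f)
⟦ φ ∧' ψ ⟧         f = ⟦ φ ⟧ f ∧ ⟦ ψ ⟧ f
⟦ φ ∨' ψ ⟧         f = ⟦ φ ⟧ f ∨ ⟦ ψ ⟧ f
⟦ φ ⇒' ψ ⟧         f = not (⟦ φ ⟧ f) ∨ ⟦ ψ ⟧ f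
⟦ φ ⇔' ψ ⟧         f = if ⟦ φ ⟧ f then ⟦ ψ ⟧ f else not (⟦ ψ ⟧ f)

data XFreeAtom (x : ℕ) : Formula → Set where
  lt-free  : ∀ {s t} → XFreeTerm x s → XFreeTerm x t → XFreeAtom x (s <' t)
  mod-free : ∀ {k k≥1 s t} → XFreeTerm x s → XFreeTerm x t →
             XFreeAtom x (congr k k≥1 s t)

data XSeparated (x : ℕ) : Formula → Set where
  sep-lt  : ∀ (a : ℕ) {t} → XFreeTerm x t → XSeparated x ((a ·v x) <' t)
  sep-gt  : ∀ (a : ℕ) {t} → XFreeTerm x t → XSeparated x (t <' (a ·v x))
  sep-mod : ∀ (a : ℕ) {k k≥1 t} → XFreeTerm x t →
            XSeparated x (congr k k≥1 (a ·v x) t)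

_∈Small : ℤ → Set
a ∈Small = (a ≡ + 0) ⊎ (a ≡ + 1) ⊎ (a ≡ - + 1) ⊎ (a ≡ + 2) ⊎ (a ≡ - + 2)

_∈Coeff_ : ℤ → Formula → Set
a ∈Coeff φ = a ∈Small ⊎
  (Σ Term λ s₁ → Σ Term λ s₂ → Σ ℕ λ i → ((s₁ <' s₂) ∈At φ) ×
     (coeffNF (s₁ ⊖ s₂) i ≢ + 0) ×
     ((a ≡ coeffNF (s₁ ⊖ s₂) i) ⊎ (a ≡ - coeffNF (s₁ ⊖ s₂) i)))

_∈Const_ : ℤ → Formula → Set
c ∈Const φ = c ∈Small ⊎
  (Σ Term λ s₁ → Σ Term λ s₂ → ((s₁ <' s₂) ∈At φ) ×
     ((c ≡ constNF (s₁ ⊖ s₂)) ⊎ (c ≡ - constNF (s₁ ⊖ s₂))))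

_∈Mod_ : ℕ → Formula → Set
k ∈Mod φ = (k ≡ 1) ⊎
  (Σ (1 ℕ.≤ k) λ k≥1 → Σ Term λ s₁ → Σ Term λ s₂ → congr k k≥1 s₁ s₂ ∈At φ)

moduli : Formula → List ℕ
moduli (s <' t)        = []
moduli (congr k _ s t) = k ∷ []
moduli (¬' φ)          = moduli φ
moduli (φ ∧' ψ)        = moduli φ ++ moduli ψ
moduli (φ ∨' ψ)        = moduli φ ++ moduli ψ
moduli (φ ⇒' ψ)        = moduli φ ++ moduli ψ
moduli (φ ⇔' ψ)        = moduli φ ++ moduli ψ

lcmMod : Formula → ℕ
lcmMod φ = foldr lcm 1 (moduli φ)

IsMaxCoeff : Formula → ℤ → Set
IsMaxCoeff φ M = (M ∈Coeff φ) × (∀ a → a ∈Coeff φ → a ℤ.≤ M)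

_∈Coeff[_]_ : ℤ → ℕ → Formula → Set
d ∈Coeff[ p ] β = Σ ℤ λ a₁ → Σ ℤ λ a₂ → Σ ℤ λ a₃ → Σ ℤ λ a₄ →
  (a₁ ∈Coeff β) × (a₂ ∈Coeff β) × (a₃ ∈Coeff β) × (a₄ ∈Coeff β) ×
  (d ≡ a₁ * a₂ - a₃ * a₄)

_∈Const[_]_ : ℤ → ℕ → Formula → Set
d ∈Const[ p ] β = Σ ℤ λ a₁ → Σ ℤ λ a₂ → Σ ℤ λ c₁ → Σ ℤ λ c₂ → Σ ℤ λ c →
  (a₁ ∈Coeff β) × (a₂ ∈Coeff β) × (c₁ ∈Const β) × (c₂ ∈Const β) ×
  (Σ ℤ λ M → IsMaxCoeff β M × (+ ∣ c ∣ ℤ.≤ M * + p * + lcmMod β)) ×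
  (d ≡ a₁ * c₁ - a₂ * (c₂ ℤ.+ c))

_∈Mod∪[_]_ : ℕ → ℕ → Formula → Set
k ∈Mod∪[ p ] β = (k ∈Mod β) ⊎ (k ≡ p)

_∈Mod[_]_ : ℤ → ℕ → Formula → Set
d ∈Mod[ p ] β = Σ ℤ λ a₁ → Σ ℤ λ a₂ → Σ ℕ λ k₁ → Σ ℕ λ k₂ →
  (a₁ ∈Coeff β) × (a₂ ∈Coeff β) × (k₁ ∈Mod∪[ p ] β) × (k₂ ∈Mod∪[ p ] β) ×
  (d ≡ a₁ * a₂ * + k₁ * + k₂)

Condition* : Formula → Formula → ℕ → Set
Condition* β γ p =
  (∀ a → a ∈Coeff γ → a ∈Coeff[ p ] β) ×
  (∀ c → c ∈Const γ → c ∈Const[ p ] β) ×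
  (∀ k → k ∈Mod γ → (+ k) ∈Mod[ p ] β)

-- On the hyperplane a x = t + c every x-separated atom can be multiplied
-- through by a > 0 and its a x-multiple replaced: b x < u becomes
-- b (t + c) < a u, u < b x becomes a u < b (t + c), and b x ≡_k u becomes
-- b (t + c) ≡_{a k} a u. Doing this atom by atom yields an x-free formula
-- with the same truth value. Its coefficients a uᵢ - b tᵢ, constants
-- a u_c - b (t_c + c) and moduli a k are built from coefficients, constants
-- and moduli of β exactly as Condition (∗) allows; the bound on |c| is met
-- because a, being a coefficient of β, is at most max Coeff(β).
module Submission where

open import Defs
open import Data.Nat using (ℕ; _≤_; _<_)
open import Data.Integer using (ℤ; +_; ∣_∣; _*_) renaming (_≤_ to _≤ℤ_)
open import Data.Product using (Σ; _×_)
open import Data.Sum using (_⊎_)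
open import Relation.Binary.PropositionalEquality using (_≡_)

open import Algebra.Properties.CommutativeSemigroup using (x∙yz≈y∙xz)
open import Data.Bool using (not; _∧_; _∨_; if_then_else_)
open import Data.Integer using (_+_; _-_; -_; _⊔_)
import Data.Integer as ℤ
import Data.Integer.Properties as ℤP
open import Data.Integer.Tactic.RingSolver using (solve-∀)
open import Data.List using (List; []; _∷_; map; _++_)
open import Data.List.Extrema ℤP.≤-totalOrder using (max; argmax-all; ⊥≤max; xs≤max)
open import Data.List.Membership.Propositional using (_∈_)
open import Data.List.Membership.Propositional.Properties using (∈-map⁺; ∈-++⁺ˡ; ∈-++⁺ʳ)
open import Data.List.Relation.Unary.All using (All; []; lookup; universal)
open import Data.List.Relation.Unary.All.Properties using (map⁺; ++⁺)
open import Data.List.Relation.Unary.Any using (here)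
import Data.Nat as ℕ
import Data.Nat.Divisibility as ℕD
import Data.Nat.Properties as ℕP
open import Data.Product using (_,_)
open import Data.Sum using (inj₁; inj₂; [_,_]′)
open import Function using (_∘_; _⇔_; mk⇔)
open import Relation.Binary.PropositionalEquality
  using (refl; sym; trans; cong; cong₂; subst; _≢_; module ≡-Reasoning)
open import Relation.Nullary using (Dec; yes; no; contradiction)
open import Relation.Nullary.Decidable using (⌊_⌋; isYes≗does; does-⇔)

open ≡-Reasoning

-- Replacing the atoms of a formula

mapAtoms : (φ : Formula) → (∀ θ → θ ∈At φ → Formula) → Formula
mapAtoms (s <' u)          g = g _ here-lt
mapAtoms (congr k k≥1 s u) g = g _ here-mod
mapAtoms (¬' φ)            g = ¬' mapAtoms φ (λ θ → g θ ∘ in-¬)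
mapAtoms (φ ∧' ψ)          g =
  mapAtoms φ (λ θ → g θ ∘ in-∧ˡ) ∧' mapAtoms ψ (λ θ → g θ ∘ in-∧ʳ)
mapAtoms (φ ∨' ψ)          g =
  mapAtoms φ (λ θ → g θ ∘ in-∨ˡ) ∨' mapAtoms ψ (λ θ → g θ ∘ in-∨ʳ)
mapAtoms (φ ⇒' ψ)          g =
  mapAtoms φ (λ θ → g θ ∘ in-⇒ˡ) ⇒' mapAtoms ψ (λ θ → g θ ∘ in-⇒ʳ)
mapAtoms (φ ⇔' ψ)          g =
  mapAtoms φ (λ θ → g θ ∘ in-⇔ˡ) ⇔' mapAtoms ψ (λ θ → g θ ∘ in-⇔ʳ)

AtomOrigin : (φ : Formula) → (∀ θ → θ ∈At φ → Formula) → Formula → Set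
AtomOrigin φ g θ′ = Σ Formula λ θ → Σ (θ ∈At φ) λ θ∈φ → θ′ ∈At g θ θ∈φ

AtomOrigin-lift : ∀ {φ χ g θ′} (inj : ∀ {θ} → θ ∈At φ → θ ∈At χ) →
                  AtomOrigin φ (λ θ → g θ ∘ inj) θ′ → AtomOrigin χ g θ′
AtomOrigin-lift inj (θ , θ∈φ , θ′∈) = θ , inj θ∈φ , θ′∈

∈At-mapAtoms⁻ : ∀ φ g {θ′} → θ′ ∈At mapAtoms φ g → AtomOrigin φ g θ′
∈At-mapAtoms⁻ (s <' u)          g θ′∈ = _ , here-lt , θ′∈
∈At-mapAtoms⁻ (congr k k≥1 s u) g θ′∈ = _ , here-mod , θ′∈
∈At-mapAtoms⁻ (¬' φ)   g (in-¬ θ′∈)  = AtomOrigin-lift in-¬ (∈At-mapAtoms⁻ φ _ θ′∈)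
∈At-mapAtoms⁻ (φ ∧' ψ) g (in-∧ˡ θ′∈) = AtomOrigin-lift in-∧ˡ (∈At-mapAtoms⁻ φ _ θ′∈)
∈At-mapAtoms⁻ (φ ∧' ψ) g (in-∧ʳ θ′∈) = AtomOrigin-lift in-∧ʳ (∈At-mapAtoms⁻ ψ _ θ′∈)
∈At-mapAtoms⁻ (φ ∨' ψ) g (in-∨ˡ θ′∈) = AtomOrigin-lift in-∨ˡ (∈At-mapAtoms⁻ φ _ θ′∈)
∈At-mapAtoms⁻ (φ ∨' ψ) g (in-∨ʳ θ′∈) = AtomOrigin-lift in-∨ʳ (∈At-mapAtoms⁻ ψ _ θ′∈)
∈At-mapAtoms⁻ (φ ⇒' ψ) g (in-⇒ˡ θ′∈) = AtomOrigin-lift in-⇒ˡ (∈At-mapAtoms⁻ φ _ θ′∈)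
∈At-mapAtoms⁻ (φ ⇒' ψ) g (in-⇒ʳ θ′∈) = AtomOrigin-lift in-⇒ʳ (∈At-mapAtoms⁻ ψ _ θ′∈)
∈At-mapAtoms⁻ (φ ⇔' ψ) g (in-⇔ˡ θ′∈) = AtomOrigin-lift in-⇔ˡ (∈At-mapAtoms⁻ φ _ θ′∈)
∈At-mapAtoms⁻ (φ ⇔' ψ) g (in-⇔ʳ θ′∈) = AtomOrigin-lift in-⇔ʳ (∈At-mapAtoms⁻ ψ _ θ′∈)

⟦⟧-mapAtoms : ∀ φ g f → (∀ θ θ∈φ → ⟦ θ ⟧ f ≡ ⟦ g θ θ∈φ ⟧ f) → ⟦ φ ⟧ f ≡ ⟦ mapAtoms φ g ⟧ f
⟦⟧-mapAtoms (s <' u)          g f eq = eq _ here-lt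
⟦⟧-mapAtoms (congr k k≥1 s u) g f eq = eq _ here-mod
⟦⟧-mapAtoms (¬' φ)            g f eq = cong not (⟦⟧-mapAtoms φ _ f (λ θ → eq θ ∘ in-¬))
⟦⟧-mapAtoms (φ ∧' ψ)          g f eq =
  cong₂ _∧_ (⟦⟧-mapAtoms φ _ f (λ θ → eq θ ∘ in-∧ˡ)) (⟦⟧-mapAtoms ψ _ f (λ θ → eq θ ∘ in-∧ʳ))
⟦⟧-mapAtoms (φ ∨' ψ)          g f eq =
  cong₂ _∨_ (⟦⟧-mapAtoms φ _ f (λ θ → eq θ ∘ in-∨ˡ)) (⟦⟧-mapAtoms ψ _ f (λ θ → eq θ ∘ in-∨ʳ))
⟦⟧-mapAtoms (φ ⇒' ψ)          g f eq =
  cong₂ (λ u v → not u ∨ v)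
        (⟦⟧-mapAtoms φ _ f (λ θ → eq θ ∘ in-⇒ˡ)) (⟦⟧-mapAtoms ψ _ f (λ θ → eq θ ∘ in-⇒ʳ))
⟦⟧-mapAtoms (φ ⇔' ψ)          g f eq =
  cong₂ (λ u v → if u then v else not v)
        (⟦⟧-mapAtoms φ _ f (λ θ → eq θ ∘ in-⇔ˡ)) (⟦⟧-mapAtoms ψ _ f (λ θ → eq θ ∘ in-⇔ʳ))

-[i-j]≡j-i : ∀ i j → - (i - j) ≡ j - i
-[i-j]≡j-i = solve-∀

coeffNF-⊖ : ∀ s u i → coeffNF (s ⊖ u) i ≡ coeffNF s i - coeffNF u i
coeffNF-⊖ s u i = cong (_+_ (coeffNF s i)) (ℤP.-1*i≡-i (coeffNF u i))

constNF-⊖ : ∀ s u → constNF (s ⊖ u) ≡ constNF s - constNF u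
constNF-⊖ s u = cong (_+_ (constNF s)) (ℤP.-1*i≡-i (constNF u))

coeffNF-⊖-swap : ∀ s u i → coeffNF (s ⊖ u) i ≡ - coeffNF (u ⊖ s) i
coeffNF-⊖-swap s u i = begin
  coeffNF (s ⊖ u) i              ≡⟨ coeffNF-⊖ s u i ⟩
  coeffNF s i - coeffNF u i      ≡⟨ -[i-j]≡j-i (coeffNF u i) (coeffNF s i) ⟨
  - (coeffNF u i - coeffNF s i)  ≡⟨ cong -_ (coeffNF-⊖ u s i) ⟨
  - coeffNF (u ⊖ s) i            ∎

constNF-⊖-swap : ∀ s u → constNF (s ⊖ u) ≡ - constNF (u ⊖ s)
constNF-⊖-swap s u = begin
  constNF (s ⊖ u)            ≡⟨ constNF-⊖ s u ⟩
  constNF s - constNF u      ≡⟨ -[i-j]≡j-i (constNF u) (constNF s) ⟨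
  - (constNF u - constNF s)  ≡⟨ cong -_ (constNF-⊖ u s) ⟨
  - constNF (u ⊖ s)          ∎

coeffNF-·v-≡ : ∀ b x → coeffNF (b ·v x) x ≡ + b
coeffNF-·v-≡ b x with x ℕ.≟ x
... | yes _   = ℤP.*-identityʳ (+ b)
... | no x≢x = contradiction refl x≢x

coeffNF-·v-≢ : ∀ b {x i} → x ≢ i → coeffNF (b ·v x) i ≡ + 0
coeffNF-·v-≢ b {x} {i} x≢i with x ℕ.≟ i
... | yes x≡i = contradiction x≡i x≢i
... | no _    = ℤP.*-zeroʳ (+ b)

constNF-·v : ∀ b x → constNF (b ·v x) ≡ + 0
constNF-·v b x = ℤP.*-zeroʳ (+ b)

scale-xFree : ∀ {x} k s → XFreeTerm x s → XFreeTerm x (scale k s)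
scale-xFree k s s₀ = trans (cong (k *_) s₀) (ℤP.*-zeroʳ k)

⊕-xFree : ∀ {x} s u → XFreeTerm x s → XFreeTerm x u → XFreeTerm x (s ⊕ u)
⊕-xFree s u s₀ u₀ = cong₂ _+_ s₀ u₀

vars : Term → List ℕ
vars (var j)     = j ∷ []
vars (const c)   = []
vars (s ⊕ u)     = vars s ++ vars u
vars (scale k s) = vars s

coeffNF≢0⇒∈vars : ∀ s {i} → coeffNF s i ≢ + 0 → i ∈ vars s
coeffNF≢0⇒∈vars (var j) {i} sᵢ≢0 with j ℕ.≟ i
... | yes refl = here refl
... | no _     = contradiction refl sᵢ≢0
coeffNF≢0⇒∈vars (const c) sᵢ≢0 = contradiction refl sᵢ≢0
coeffNF≢0⇒∈vars (s ⊕ u) {i} sᵢ+uᵢ≢0 with coeffNF s i ℤ.≟ + 0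
... | yes sᵢ≡0 = ∈-++⁺ʳ (vars s) (coeffNF≢0⇒∈vars u (sᵢ+uᵢ≢0 ∘ cong₂ _+_ sᵢ≡0))
... | no sᵢ≢0  = ∈-++⁺ˡ (coeffNF≢0⇒∈vars s sᵢ≢0)
coeffNF≢0⇒∈vars (scale k s) {i} ksᵢ≢0 =
  coeffNF≢0⇒∈vars s (λ sᵢ≡0 → ksᵢ≢0 (trans (cong (k *_) sᵢ≡0) (ℤP.*-zeroʳ k)))

-‿∈Small : ∀ {z} → z ∈Small → (- z) ∈Small
-‿∈Small (inj₁ refl)                         = inj₁ refl
-‿∈Small (inj₂ (inj₁ refl))                  = inj₂ (inj₂ (inj₁ refl))
-‿∈Small (inj₂ (inj₂ (inj₁ refl)))           = inj₂ (inj₁ refl)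
-‿∈Small (inj₂ (inj₂ (inj₂ (inj₁ refl))))    = inj₂ (inj₂ (inj₂ (inj₂ refl)))
-‿∈Small (inj₂ (inj₂ (inj₂ (inj₂ refl))))    = inj₂ (inj₂ (inj₂ (inj₁ refl)))

∈Small⇒≤2 : ∀ {z} → z ∈Small → z ≤ℤ + 2
∈Small⇒≤2 (inj₁ refl)                      = ℤ.+≤+ ℕ.z≤n
∈Small⇒≤2 (inj₂ (inj₁ refl))               = ℤ.+≤+ (ℕ.s≤s ℕ.z≤n)
∈Small⇒≤2 (inj₂ (inj₂ (inj₁ refl)))        = ℤ.-≤+
∈Small⇒≤2 (inj₂ (inj₂ (inj₂ (inj₁ refl)))) = ℤP.≤-refl
∈Small⇒≤2 (inj₂ (inj₂ (inj₂ (inj₂ refl)))) = ℤ.-≤+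

0∈Coeff : ∀ {φ} → (+ 0) ∈Coeff φ
0∈Coeff = inj₁ (inj₁ refl)

1∈Coeff : ∀ {φ} → (+ 1) ∈Coeff φ
1∈Coeff = inj₁ (inj₂ (inj₁ refl))

2∈Coeff : ∀ {φ} → (+ 2) ∈Coeff φ
2∈Coeff = inj₁ (inj₂ (inj₂ (inj₂ (inj₁ refl))))

-‿∈Coeff : ∀ {φ z} → z ∈Coeff φ → (- z) ∈Coeff φ
-‿∈Coeff (inj₁ z∈)                              = inj₁ (-‿∈Small z∈)
-‿∈Coeff (inj₂ (s , u , i , m , ≢0 , inj₁ z≡))  = inj₂ (s , u , i , m , ≢0 , inj₂ (cong -_ z≡))
-‿∈Coeff (inj₂ (s , u , i , m , ≢0 , inj₂ z≡))  =
  inj₂ (s , u , i , m , ≢0 , inj₁ (trans (cong -_ z≡) (ℤP.neg-involutive _)))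

-‿∈Const : ∀ {φ z} → z ∈Const φ → (- z) ∈Const φ
-‿∈Const (inj₁ z∈)                  = inj₁ (-‿∈Small z∈)
-‿∈Const (inj₂ (s , u , m , inj₁ z≡)) = inj₂ (s , u , m , inj₂ (cong -_ z≡))
-‿∈Const (inj₂ (s , u , m , inj₂ z≡)) =
  inj₂ (s , u , m , inj₁ (trans (cong -_ z≡) (ℤP.neg-involutive _)))

-- Coeff lists only the nonzero coefficients of atoms; a zero one is covered by 0 ∈ Small.
coeffNF-⊖∈Coeff : ∀ {φ s u} → (s <' u) ∈At φ → ∀ i → coeffNF (s ⊖ u) i ∈Coeff φ
coeffNF-⊖∈Coeff {φ} {s} {u} m i = by-cases (coeffNF (s ⊖ u) i ℤ.≟ + 0)
  where
  by-cases : Dec (coeffNF (s ⊖ u) i ≡ + 0) → coeffNF (s ⊖ u) i ∈Coeff φ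
  by-cases (yes ≡0) = inj₁ (inj₁ ≡0)
  by-cases (no ≢0)  = inj₂ (s , u , i , m , ≢0 , inj₁ refl)

constNF-⊖∈Const : ∀ {φ s u} → (s <' u) ∈At φ → constNF (s ⊖ u) ∈Const φ
constNF-⊖∈Const m = inj₂ (_ , _ , m , inj₁ refl)

Compares : Formula → Term → Term → Set
Compares φ s u = ((s <' u) ∈At φ) ⊎ ((u <' s) ∈At φ)

compares⇒coeffNF-⊖∈Coeff : ∀ {φ s u} → Compares φ s u → ∀ i → coeffNF (s ⊖ u) i ∈Coeff φ
compares⇒coeffNF-⊖∈Coeff         (inj₁ m) i = coeffNF-⊖∈Coeff m i
compares⇒coeffNF-⊖∈Coeff {φ} {s} {u} (inj₂ m) i =
  subst (_∈Coeff φ) (sym (coeffNF-⊖-swap s u i)) (-‿∈Coeff (coeffNF-⊖∈Coeff m i))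

compares⇒constNF-⊖∈Const : ∀ {φ s u} → Compares φ s u → constNF (s ⊖ u) ∈Const φ
compares⇒constNF-⊖∈Const         (inj₁ m) = constNF-⊖∈Const m
compares⇒constNF-⊖∈Const {φ} {s} {u} (inj₂ m) =
  subst (_∈Const φ) (sym (constNF-⊖-swap s u)) (-‿∈Const (constNF-⊖∈Const m))

module _ {φ x b u} (cmp : Compares φ (b ·v x) u) where

  scalar∈Coeff : XFreeTerm x u → (+ b) ∈Coeff φ
  scalar∈Coeff u₀ = subst (_∈Coeff φ) eq (compares⇒coeffNF-⊖∈Coeff cmp x)
    where
    eq : coeffNF ((b ·v x) ⊖ u) x ≡ + b
    eq = begin
      coeffNF ((b ·v x) ⊖ u) x           ≡⟨ coeffNF-⊖ (b ·v x) u x ⟩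
      coeffNF (b ·v x) x - coeffNF u x   ≡⟨ cong₂ _-_ (coeffNF-·v-≡ b x) u₀ ⟩
      + b - + 0                          ≡⟨ ℤP.+-identityʳ (+ b) ⟩
      + b                                ∎

  coeffNF∈Coeff : XFreeTerm x u → ∀ i → coeffNF u i ∈Coeff φ
  coeffNF∈Coeff u₀ i with i ℕ.≟ x
  ... | yes refl = subst (_∈Coeff φ) (sym u₀) 0∈Coeff
  ... | no i≢x   = subst (_∈Coeff φ) eq (-‿∈Coeff (compares⇒coeffNF-⊖∈Coeff cmp i))
    where
    eq : - coeffNF ((b ·v x) ⊖ u) i ≡ coeffNF u i
    eq = begin
      - coeffNF ((b ·v x) ⊖ u) i            ≡⟨ cong -_ (coeffNF-⊖ (b ·v x) u i) ⟩
      - (coeffNF (b ·v x) i - coeffNF u i)  ≡⟨ -[i-j]≡j-i (coeffNF (b ·v x) i) (coeffNF u i) ⟩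
      coeffNF u i - coeffNF (b ·v x) i      ≡⟨ cong (_-_ (coeffNF u i)) (coeffNF-·v-≢ b (i≢x ∘ sym)) ⟩
      coeffNF u i - + 0                     ≡⟨ ℤP.+-identityʳ (coeffNF u i) ⟩
      coeffNF u i                           ∎

  constNF∈Const : constNF u ∈Const φ
  constNF∈Const = subst (_∈Const φ) eq (-‿∈Const (compares⇒constNF-⊖∈Const cmp))
    where
    eq : - constNF ((b ·v x) ⊖ u) ≡ constNF u
    eq = begin
      - constNF ((b ·v x) ⊖ u)           ≡⟨ cong -_ (constNF-⊖ (b ·v x) u) ⟩
      - (constNF (b ·v x) - constNF u)   ≡⟨ -[i-j]≡j-i (constNF (b ·v x)) (constNF u) ⟩
      constNF u - constNF (b ·v x)       ≡⟨ cong (_-_ (constNF u)) (constNF-·v b x) ⟩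
      constNF u - + 0                    ≡⟨ ℤP.+-identityʳ (constNF u) ⟩
      constNF u                          ∎

-- Existence of max Coeff(φ)

IsMaximum : (ℤ → Set) → ℤ → Set
IsMaximum P M = P M × (∀ z → P z → z ≤ℤ M)

isMaximum-max : ∀ {P : ℤ → Set} {d xs} → P d → All P xs →
                (∀ z → P z → z ≤ℤ d ⊎ z ∈ xs) → IsMaximum P (max d xs)
isMaximum-max {d = d} {xs} Pd Pxs bounded =
  argmax-all (λ z → z) Pd Pxs ,
  λ z Pz → [ (λ z≤d → ℤP.≤-trans z≤d (⊥≤max d xs)) , lookup (xs≤max d xs) ]′ (bounded z Pz)

isMaximum-⊔ : ∀ {P Q R : ℤ → Set} {M N} →
              (∀ z → P z → R z) → (∀ z → Q z → R z) → (∀ z → R z → P z ⊎ Q z) →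
              IsMaximum P M → IsMaximum Q N → IsMaximum R (M ⊔ N)
isMaximum-⊔ {R = R} {M} {N} P⊆R Q⊆R R⊆P∪Q (PM , ≤M) (QN , ≤N) =
  [ (λ ≡M → subst R (sym ≡M) (P⊆R M PM)) , (λ ≡N → subst R (sym ≡N) (Q⊆R N QN)) ]′ (ℤP.⊔-sel M N) ,
  λ z Rz → [ (λ Pz → ℤP.≤-trans (≤M z Pz) (ℤP.i≤i⊔j M N)) ,
             (λ Qz → ℤP.≤-trans (≤N z Qz) (ℤP.i≤j⊔i M N)) ]′ (R⊆P∪Q z Rz)

∈Coeff-⊆ : ∀ {φ χ} → (∀ {θ} → θ ∈At φ → θ ∈At χ) → ∀ z → z ∈Coeff φ → z ∈Coeff χ
∈Coeff-⊆ φ⊆χ z (inj₁ z∈)                       = inj₁ z∈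
∈Coeff-⊆ φ⊆χ z (inj₂ (s , u , i , m , ≢0 , ≡±)) = inj₂ (s , u , i , φ⊆χ m , ≢0 , ≡±)

∈Coeff-⊆-∪ : ∀ {φ ψ χ} → (∀ {θ} → θ ∈At χ → θ ∈At φ ⊎ θ ∈At ψ) →
             ∀ z → z ∈Coeff χ → z ∈Coeff φ ⊎ z ∈Coeff ψ
∈Coeff-⊆-∪ χ⊆φ∪ψ z (inj₁ z∈) = inj₁ (inj₁ z∈)
∈Coeff-⊆-∪ χ⊆φ∪ψ z (inj₂ (s , u , i , m , ≢0 , ≡±)) =
  [ (λ m → inj₁ (inj₂ (s , u , i , m , ≢0 , ≡±))) ,
    (λ m → inj₂ (inj₂ (s , u , i , m , ≢0 , ≡±))) ]′ (χ⊆φ∪ψ m)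

maxCoeff-<' : ∀ s u → Σ ℤ (IsMaxCoeff (s <' u))
maxCoeff-<' s u = max (+ 2) cs , isMaximum-max 2∈Coeff Pcs bounded
  where
  d = s ⊖ u
  cs = map (coeffNF d) (vars d) ++ map (-_ ∘ coeffNF d) (vars d)

  Pcs : All (_∈Coeff (s <' u)) cs
  Pcs = ++⁺ (map⁺ (universal (coeffNF-⊖∈Coeff here-lt) (vars d)))
            (map⁺ (universal (-‿∈Coeff ∘ coeffNF-⊖∈Coeff here-lt) (vars d)))

  bounded : ∀ z → z ∈Coeff (s <' u) → z ≤ℤ + 2 ⊎ z ∈ cs
  bounded z (inj₁ z∈) = inj₁ (∈Small⇒≤2 z∈)
  bounded z (inj₂ (_ , _ , i , here-lt , ≢0 , inj₁ refl)) =
    inj₂ (∈-++⁺ˡ (∈-map⁺ (coeffNF d) (coeffNF≢0⇒∈vars d ≢0)))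
  bounded z (inj₂ (_ , _ , i , here-lt , ≢0 , inj₂ refl)) =
    inj₂ (∈-++⁺ʳ _ (∈-map⁺ (-_ ∘ coeffNF d) (coeffNF≢0⇒∈vars d ≢0)))

maxCoeff-∪ : ∀ {φ ψ χ} → (∀ {θ} → θ ∈At φ → θ ∈At χ) → (∀ {θ} → θ ∈At ψ → θ ∈At χ) →
             (∀ {θ} → θ ∈At χ → θ ∈At φ ⊎ θ ∈At ψ) →
             Σ ℤ (IsMaxCoeff φ) → Σ ℤ (IsMaxCoeff ψ) → Σ ℤ (IsMaxCoeff χ)
maxCoeff-∪ φ⊆χ ψ⊆χ χ⊆φ∪ψ (M , maxM) (N , maxN) =
  M ⊔ N , isMaximum-⊔ (∈Coeff-⊆ φ⊆χ) (∈Coeff-⊆ ψ⊆χ) (∈Coeff-⊆-∪ χ⊆φ∪ψ) maxM maxN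

maxCoeff : ∀ φ → Σ ℤ (IsMaxCoeff φ)
maxCoeff (s <' u)          = maxCoeff-<' s u
maxCoeff (congr k k≥1 s u) = + 2 , isMaximum-max {xs = []} 2∈Coeff [] bounded
  where
  bounded : ∀ z → z ∈Coeff congr k k≥1 s u → z ≤ℤ + 2 ⊎ z ∈ []
  bounded z (inj₁ z∈)                 = inj₁ (∈Small⇒≤2 z∈)
  bounded z (inj₂ (_ , _ , _ , () , _))
maxCoeff (¬' φ)   = maxCoeff-∪ in-¬ in-¬ (λ { (in-¬ m) → inj₁ m }) (maxCoeff φ) (maxCoeff φ)
maxCoeff (φ ∧' ψ) =
  maxCoeff-∪ in-∧ˡ in-∧ʳ (λ { (in-∧ˡ m) → inj₁ m ; (in-∧ʳ m) → inj₂ m }) (maxCoeff φ) (maxCoeff ψ)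
maxCoeff (φ ∨' ψ) =
  maxCoeff-∪ in-∨ˡ in-∨ʳ (λ { (in-∨ˡ m) → inj₁ m ; (in-∨ʳ m) → inj₂ m }) (maxCoeff φ) (maxCoeff ψ)
maxCoeff (φ ⇒' ψ) =
  maxCoeff-∪ in-⇒ˡ in-⇒ʳ (λ { (in-⇒ˡ m) → inj₁ m ; (in-⇒ʳ m) → inj₂ m }) (maxCoeff φ) (maxCoeff ψ)
maxCoeff (φ ⇔' ψ) =
  maxCoeff-∪ in-⇔ˡ in-⇔ʳ (λ { (in-⇔ˡ m) → inj₁ m ; (in-⇔ʳ m) → inj₂ m }) (maxCoeff φ) (maxCoeff ψ)

module _ {β : Formula} {p : ℕ} where

  -‿∈Coeff[] : ∀ {d} → d ∈Coeff[ p ] β → (- d) ∈Coeff[ p ] β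
  -‿∈Coeff[] (a₁ , a₂ , a₃ , a₄ , a₁∈ , a₂∈ , a₃∈ , a₄∈ , refl) =
    a₃ , a₄ , a₁ , a₂ , a₃∈ , a₄∈ , a₁∈ , a₂∈ , -[i-j]≡j-i (a₁ * a₂) (a₃ * a₄)

  -‿∈Const[] : ∀ {d} → d ∈Const[ p ] β → (- d) ∈Const[ p ] β
  -‿∈Const[] (a₁ , a₂ , c₁ , c₂ , c , a₁∈ , a₂∈ , c₁∈ , c₂∈ , c-bound , refl) =
    - a₁ , - a₂ , c₁ , c₂ , c , -‿∈Coeff a₁∈ , -‿∈Coeff a₂∈ , c₁∈ , c₂∈ , c-bound ,
    eq a₁ a₂ c₁ c₂ c
    where
    eq : ∀ a₁ a₂ c₁ c₂ c → - (a₁ * c₁ - a₂ * (c₂ + c)) ≡ (- a₁) * c₁ - (- a₂) * (c₂ + c)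
    eq = solve-∀

  ∈Small⇒∈Coeff[] : ∀ {z} → z ∈Small → z ∈Coeff[ p ] β
  ∈Small⇒∈Coeff[] {z} z∈ = z , + 1 , + 0 , + 0 , inj₁ z∈ , 1∈Coeff , 0∈Coeff , 0∈Coeff , eq z
    where
    eq : ∀ z → z ≡ z * + 1 - + 0 * + 0
    eq = solve-∀

  -- Const_p demands a bounded shift c even when its factor is 0.
  ∈Small⇒∈Const[] : ∀ {z c} → (Σ ℤ λ M → IsMaxCoeff β M × (+ ∣ c ∣ ≤ℤ M * + p * + lcmMod β)) →
                    z ∈Small → z ∈Const[ p ] β
  ∈Small⇒∈Const[] {z} {c} c-bound z∈ =
    + 1 , + 0 , z , + 0 , c , 1∈Coeff , 0∈Coeff , inj₁ z∈ , inj₁ (inj₁ refl) , c-bound , eq z c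
    where
    eq : ∀ z c → z ≡ + 1 * z - + 0 * (+ 0 + c)
    eq = solve-∀

∈Coeff-elim : ∀ {φ} {P : ℤ → Set} → (∀ {z} → z ∈Small → P z) → (∀ {z} → P z → P (- z)) →
              (∀ {s u} → (s <' u) ∈At φ → ∀ i → P (coeffNF (s ⊖ u) i)) →
              ∀ z → z ∈Coeff φ → P z
∈Coeff-elim small neg atom z (inj₁ z∈) = small z∈
∈Coeff-elim small neg atom z (inj₂ (_ , _ , i , m , _ , inj₁ refl)) = atom m i
∈Coeff-elim small neg atom z (inj₂ (_ , _ , i , m , _ , inj₂ refl)) = neg (atom m i)

∈Const-elim : ∀ {φ} {P : ℤ → Set} → (∀ {z} → z ∈Small → P z) → (∀ {z} → P z → P (- z)) →
              (∀ {s u} → (s <' u) ∈At φ → P (constNF (s ⊖ u))) →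
              ∀ z → z ∈Const φ → P z
∈Const-elim small neg atom z (inj₁ z∈) = small z∈
∈Const-elim small neg atom z (inj₂ (_ , _ , m , inj₁ refl)) = atom m
∈Const-elim small neg atom z (inj₂ (_ , _ , m , inj₂ refl)) = neg (atom m)

-- Multiplying a comparison by a positive integer

⌊⌋-⇔ : ∀ {A B : Set} → A ⇔ B → (a? : Dec A) (b? : Dec B) → ⌊ a? ⌋ ≡ ⌊ b? ⌋
⌊⌋-⇔ A⇔B a? b? = trans (isYes≗does a?) (trans (does-⇔ A⇔B a? b?) (sym (isYes≗does b?)))

module _ (a : ℕ) .{{_ : ℕ.NonZero a}} where

  *-<-⇔ : ∀ {m n} → m ℤ.< n ⇔ + a * m ℤ.< + a * n
  *-<-⇔ = mk⇔ (ℤP.*-monoˡ-<-pos (+ a) {{ℤ.positive (ℤ.+<+ (ℕ.>-nonZero⁻¹ a))}})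
              (ℤP.*-cancelˡ-<-nonNeg (+ a))

  ∣*-∣-⇔ : ∀ {k m n} → k ℕD.∣ ∣ m - n ∣ ⇔ a ℕ.* k ℕD.∣ ∣ + a * m - + a * n ∣
  ∣*-∣-⇔ {k} {m} {n} = mk⇔ (λ k∣ → subst (a ℕ.* k ℕD.∣_) (sym abs-eq) (ℕD.*-monoʳ-∣ a k∣))
                           (λ ak∣ → ℕD.*-cancelˡ-∣ a (subst (a ℕ.* k ℕD.∣_) abs-eq ak∣))
    where
    abs-eq : ∣ + a * m - + a * n ∣ ≡ a ℕ.* ∣ m - n ∣
    abs-eq = begin
      ∣ + a * m - + a * n ∣      ≡⟨ cong (λ z → ∣ + a * m + z ∣) (ℤP.neg-distribʳ-* (+ a) n) ⟩
      ∣ + a * m + + a * - n ∣    ≡⟨ cong ∣_∣ (ℤP.*-distribˡ-+ (+ a) m (- n)) ⟨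
      ∣ + a * (m - n) ∣          ≡⟨ ℤP.abs-* (+ a) (m - n) ⟩
      a ℕ.* ∣ m - n ∣            ∎

  ⌊<?⌋-scale : ∀ {m m′ n} → + a * m ≡ m′ → ⌊ m ℤP.<? n ⌋ ≡ ⌊ m′ ℤP.<? + a * n ⌋
  ⌊<?⌋-scale refl = ⌊⌋-⇔ *-<-⇔ _ _

  ⌊>?⌋-scale : ∀ {m m′ n} → + a * m ≡ m′ → ⌊ n ℤP.<? m ⌋ ≡ ⌊ + a * n ℤP.<? m′ ⌋
  ⌊>?⌋-scale refl = ⌊⌋-⇔ *-<-⇔ _ _

  ⌊∣?⌋-scale : ∀ {k m m′ n} → + a * m ≡ m′ →
               ⌊ k ℕD.∣? ∣ m - n ∣ ⌋ ≡ ⌊ a ℕ.* k ℕD.∣? ∣ m′ - + a * n ∣ ⌋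
  ⌊∣?⌋-scale refl = ⌊⌋-⇔ ∣*-∣-⇔ _ _

-- Substituting t + c for a x

module Substitution (x a : ℕ) .{{_ : ℕ.NonZero a}} (t : Term) (c : ℤ) where

  infix 30 _·[t+c]
  _·[t+c] : ℕ → Term
  b ·[t+c] = scale (+ b) (t ⊕ const c)

  substAtom : ∀ {θ} → XSeparated x θ → Formula
  substAtom (sep-lt b {u} _) = b ·[t+c] <' scale (+ a) u
  substAtom (sep-gt b {u} _) = scale (+ a) u <' b ·[t+c]
  substAtom (sep-mod b {k} {k≥1} {u} _) =
    congr (a ℕ.* k) (ℕP.*-mono-≤ (ℕ.>-nonZero⁻¹ a) k≥1) (b ·[t+c]) (scale (+ a) u)

  substitute : (β : Formula) → (∀ θ → θ ∈At β → XSeparated x θ) → Formula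
  substitute β sep = mapAtoms β (λ θ θ∈β → substAtom (sep θ θ∈β))

  module _ (f : Assignment) (ax≡t+c : eval f (a ·v x) ≡ eval f (t ⊕ const c)) where

    *-·v : ∀ b → + a * eval f (b ·v x) ≡ eval f (b ·[t+c])
    *-·v b = begin
      + a * (+ b * f x)  ≡⟨ x∙yz≈y∙xz ℤP.*-commutativeSemigroup (+ a) (+ b) (f x) ⟩
      + b * (+ a * f x)  ≡⟨ cong (+ b *_) ax≡t+c ⟩
      eval f (b ·[t+c])  ∎

    substAtom-sound : ∀ {θ} (sep : XSeparated x θ) → ⟦ θ ⟧ f ≡ ⟦ substAtom sep ⟧ f
    substAtom-sound (sep-lt b _)  = ⌊<?⌋-scale a (*-·v b)
    substAtom-sound (sep-gt b _)  = ⌊>?⌋-scale a (*-·v b)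
    substAtom-sound (sep-mod b _) = ⌊∣?⌋-scale a (*-·v b)

  substitute-sound : ∀ β sep (f : Assignment) → eval f (a ·v x) ≡ eval f (t ⊕ const c) →
                     ⟦ β ⟧ f ≡ ⟦ substitute β sep ⟧ f
  substitute-sound β sep f ax≡t+c =
    ⟦⟧-mapAtoms β _ f (λ θ θ∈β → substAtom-sound f ax≡t+c (sep θ θ∈β))

  module _ (t₀ : XFreeTerm x t) where

    ·[t+c]-xFree : ∀ b → XFreeTerm x (b ·[t+c])
    ·[t+c]-xFree b = scale-xFree (+ b) (t ⊕ const c) (⊕-xFree t (const c) t₀ refl)

    substAtom-xFree : ∀ {θ θ′} (sep : XSeparated x θ) → θ′ ∈At substAtom sep → XFreeAtom x θ′
    substAtom-xFree (sep-lt b {u} u₀)  here-lt  = lt-free (·[t+c]-xFree b) (scale-xFree (+ a) u u₀)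
    substAtom-xFree (sep-gt b {u} u₀)  here-lt  = lt-free (scale-xFree (+ a) u u₀) (·[t+c]-xFree b)
    substAtom-xFree (sep-mod b {t = u} u₀) here-mod =
      mod-free (·[t+c]-xFree b) (scale-xFree (+ a) u u₀)

    substitute-xFree : ∀ β sep θ′ → θ′ ∈At substitute β sep → XFreeAtom x θ′
    substitute-xFree β sep θ′ θ′∈ =
      let θ , θ∈β , θ′∈′ = ∈At-mapAtoms⁻ β _ θ′∈ in substAtom-xFree (sep θ θ∈β) θ′∈′

  module Condition (β : Formula) (sep : ∀ θ → θ ∈At β → XSeparated x θ)
                   (t₀ : XFreeTerm x t) (ax⋈t : Compares β (a ·v x) t)
                   (p : ℕ) (|c|≤ : + ∣ c ∣ ≤ℤ + a * + p * + lcmMod β) where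

    a∈Coeff : (+ a) ∈Coeff β
    a∈Coeff = scalar∈Coeff ax⋈t t₀

    c-bound : Σ ℤ λ M → IsMaxCoeff β M × (+ ∣ c ∣ ≤ℤ M * + p * + lcmMod β)
    c-bound = let M , M∈ , ≤M = maxCoeff β in
      M , (M∈ , ≤M) ,
      ℤP.≤-trans |c|≤ (ℤP.*-monoʳ-≤-nonNeg (+ lcmMod β)
                        (ℤP.*-monoʳ-≤-nonNeg (+ p) (≤M (+ a) a∈Coeff)))

    module _ {b u} (bx⋈u : Compares β (b ·v x) u) (u₀ : XFreeTerm x u) where

      coeffNF-sides∈Coeff[] : ∀ i → coeffNF (scale (+ a) u ⊖ b ·[t+c]) i ∈Coeff[ p ] β
      coeffNF-sides∈Coeff[] i =
        + a , coeffNF u i , + b , coeffNF t i + + 0 ,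
        a∈Coeff , coeffNF∈Coeff bx⋈u u₀ i , scalar∈Coeff bx⋈u u₀ ,
        subst (_∈Coeff β) (sym (ℤP.+-identityʳ (coeffNF t i))) (coeffNF∈Coeff ax⋈t t₀ i) ,
        coeffNF-⊖ (scale (+ a) u) (b ·[t+c]) i

      constNF-sides∈Const[] : constNF (scale (+ a) u ⊖ b ·[t+c]) ∈Const[ p ] β
      constNF-sides∈Const[] =
        + a , + b , constNF u , constNF t , c ,
        a∈Coeff , scalar∈Coeff bx⋈u u₀ , constNF∈Const bx⋈u , constNF∈Const ax⋈t , c-bound ,
        constNF-⊖ (scale (+ a) u) (b ·[t+c])

    substAtom-coeff : ∀ {θ s₁ s₂} (θ∈β : θ ∈At β) → (s₁ <' s₂) ∈At substAtom (sep θ θ∈β) →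
                      ∀ i → coeffNF (s₁ ⊖ s₂) i ∈Coeff[ p ] β
    substAtom-coeff {θ} θ∈β m i with sep θ θ∈β | m
    ... | sep-lt b {u} u₀ | here-lt =
      subst (_∈Coeff[ p ] β) (sym (coeffNF-⊖-swap (b ·[t+c]) (scale (+ a) u) i))
            (-‿∈Coeff[] {p = p} (coeffNF-sides∈Coeff[] (inj₁ θ∈β) u₀ i))
    ... | sep-gt b u₀     | here-lt = coeffNF-sides∈Coeff[] (inj₂ θ∈β) u₀ i
    ... | sep-mod b u₀    | ()

    substAtom-const : ∀ {θ s₁ s₂} (θ∈β : θ ∈At β) → (s₁ <' s₂) ∈At substAtom (sep θ θ∈β) →
                      constNF (s₁ ⊖ s₂) ∈Const[ p ] β
    substAtom-const {θ} θ∈β m with sep θ θ∈β | m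
    ... | sep-lt b {u} u₀ | here-lt =
      subst (_∈Const[ p ] β) (sym (constNF-⊖-swap (b ·[t+c]) (scale (+ a) u)))
            (-‿∈Const[] (constNF-sides∈Const[] (inj₁ θ∈β) u₀))
    ... | sep-gt b u₀     | here-lt = constNF-sides∈Const[] (inj₂ θ∈β) u₀
    ... | sep-mod b u₀    | ()

    substAtom-mod : ∀ {θ k k≥1 s₁ s₂} (θ∈β : θ ∈At β) →
                    congr k k≥1 s₁ s₂ ∈At substAtom (sep θ θ∈β) → (+ k) ∈Mod[ p ] β
    substAtom-mod {θ} θ∈β m with sep θ θ∈β | m
    ... | sep-lt b u₀               | ()
    ... | sep-gt b u₀               | ()
    ... | sep-mod b {k} {k≥1} u₀    | here-mod =
      + a , + 1 , k , 1 , a∈Coeff , 1∈Coeff , inj₁ (inj₂ (k≥1 , _ , _ , θ∈β)) , inj₁ (inj₁ refl) ,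
      trans (ℤP.pos-* a k) (eq (+ a) (+ k))
      where
      eq : ∀ a k → a * k ≡ a * + 1 * k * + 1
      eq = solve-∀

    substitute-condition : Condition* β (substitute β sep) p
    substitute-condition =
      ∈Coeff-elim (∈Small⇒∈Coeff[] {p = p}) (-‿∈Coeff[] {p = p})
        (λ m → let θ , θ∈β , m′ = ∈At-mapAtoms⁻ β _ m in substAtom-coeff θ∈β m′) ,
      ∈Const-elim (∈Small⇒∈Const[] {c = c} c-bound) -‿∈Const[]
        (λ m → let θ , θ∈β , m′ = ∈At-mapAtoms⁻ β _ m in substAtom-const θ∈β m′) ,
      λ where
        _ (inj₁ refl) →
          + 1 , + 1 , 1 , 1 , 1∈Coeff , 1∈Coeff , inj₁ (inj₁ refl) , inj₁ (inj₁ refl) , refl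
        _ (inj₂ (_ , _ , _ , m)) → let θ , θ∈β , m′ = ∈At-mapAtoms⁻ β _ m in substAtom-mod θ∈β m′

lemma4p1 : (x : ℕ) (β : Formula) →
    (∀ φ → φ ∈At β → XSeparated x φ) →
    (a : ℕ) → 0 < a → (t : Term) → XFreeTerm x t →
    ((((a ·v x) <' t) ∈At β) ⊎ ((t <' (a ·v x)) ∈At β)) →
    (p : ℕ) → 1 ≤ p →
    (c : ℤ) → + ∣ c ∣ ≤ℤ + a * + p * + lcmMod β →
    Σ Formula λ γ →
      (∀ φ → φ ∈At γ → XFreeAtom x φ) ×
      Condition* β γ p ×
      (∀ (f : Assignment) → eval f (a ·v x) ≡ eval f (t ⊕ const c) →
        ⟦ β ⟧ f ≡ ⟦ γ ⟧ f)
lemma4p1 x β sep a a>0 t t₀ ax⋈t p _ c |c|≤ =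
  substitute β sep ,
  substitute-xFree t₀ β sep ,
  Condition.substitute-condition β sep t₀ ax⋈t p |c|≤ ,
  substitute-sound β sep
  where open Substitution x a {{ℕ.>-nonZero a>0}} t c
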